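{- For $n=3,4,5$, the graph $Q_n$ (the $4\times n$ grid with one sticky end) admits an $(n+3)$-ranking; that is, $Q_3$ has a $6$-ranking, $Q_4$ has a $7$-ranking, and $Q_5$ has an $8$-ranking.
   Context: A $k$-ranking of a graph $G$ is a labeling $f:V(G)\to\{1,\dots,k\}$ such that every path between two distinct vertices with the same label contains a vertex with a larger label. $Q_n$ is the induced subgraph of the infinite grid on $\mathbb{Z}^2$ (vertices adjacent iff they agree in one coordinate and differ by $1$ in the other) on $\{(i,j):1\le i\le 4,\ 1\le j\le n+i-1\}$, i.e. the $4\times n$ grid with a staircase of $0,1,2,3$ extra vertices appended to the right of rows $1,2,3,4$. -}

module Defs where

open import Data.Nat using (ℕ; suc; _+_; _≤_; _<_)
open import Data.Fin using (Fin; toℕ)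
open import Data.Product using (Σ; _×_; ∃-syntax; _,_)
open import Data.Sum using (_⊎_)
open import Data.List using (List; []; _∷_)
open import Data.List.Membership.Propositional using (_∈_)
open import Data.List.Relation.Unary.Unique.Propositional using (Unique)
open import Relation.Binary.PropositionalEquality using (_≡_; _≢_)
open import Relation.Nullary using (¬_)

record Graph : Set₁ where
  field
    V   : Set
    Adj : V → V → Set
open Graph public

data Walk (G : Graph) : V G → V G → Set where
  here : (u : V G) → Walk G u u
  step : (u w : V G) {v : V G} → Adj G u w → Walk G w v → Walk G u v

vertices : {G : Graph} {u v : V G} → Walk G u v → List (V G)
vertices (here u) = u ∷ []
vertices (step u w _ p) = u ∷ vertices p

IsPath : {G : Graph} {u v : V G} → Walk G u v → Set
IsPath p = Unique (vertices p)

IsRanking : (G : Graph) (k : ℕ) (f : V G → ℕ) → Set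
IsRanking G k f =
  (∀ v → 1 ≤ f v × f v ≤ k) ×
  (∀ (u v : V G) → u ≢ v → f u ≡ f v → (p : Walk G u v) → IsPath p →
     ∃[ w ] (w ∈ vertices p × f u < f w))

HasRanking : (G : Graph) (k : ℕ) → Set
HasRanking G k = ∃[ f ] IsRanking G k f

Diff1 : ℕ → ℕ → Set
Diff1 a b = suc a ≡ b ⊎ suc b ≡ a

-- Q n, 0-indexed: rows i ∈ {0,1,2,3}; row i has columns 0 … n+i-1
-- (paper's row i+1 has columns 1 … n+i). Induced subgraph of the grid ℤ².
QVertex : ℕ → Set
QVertex n = Σ (Fin 4) (λ i → Fin (n + toℕ i))

QAdj : (n : ℕ) → QVertex n → QVertex n → Set
QAdj n (i , j) (i' , j') =
  (toℕ i ≡ toℕ i' × Diff1 (toℕ j) (toℕ j')) ⊎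
  (toℕ j ≡ toℕ j' × Diff1 (toℕ i) (toℕ i'))

Q : ℕ → Graph
Q n = record { V = QVertex n ; Adj = QAdj n }

module Submission where

-- A labelling f is a ranking as soon as, for every level c, the vertices of label c
-- lie in pairwise distinct components of the subgraph induced by {v ∣ f v ≤ c}: a walk
-- between two such vertices must then leave that subgraph, i.e. pass through a vertex of
-- larger label.  Component labels are easy to certify (constant along edges, distinct on
-- the level-c vertices), so for the explicit labellings of Q₃, Q₄ and Q₅ below it suffices
-- to compute candidate component labels by propagating minima and let the type checker
-- verify the certificate.

open import Defs
open import Data.Bool using (Bool; if_then_else_; _∧_)
open import Data.Fin using (toℕ; zero; suc)
open import Data.Fin.Properties using (all?) renaming (_≟_ to _≟ᶠ_)
open import Data.List using (List; []; _∷_; map; foldr; concatMap; allFin; length; zip; upTo)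
open import Data.List.Membership.Propositional using (_∈_)
open import Data.List.Relation.Unary.Any using (here; there)
open import Data.Nat using (ℕ; _+_; _≤_; _<_; _≤ᵇ_; _⊓_; _≤?_; s≤s)
open import Data.Nat.GeneralisedArithmetic using (fold)
open import Data.Nat.Properties using (_≟_; ≤-refl; ≰⇒>; allUpTo?)
open import Data.Product using (_×_; _,_; proj₂; ∃-syntax; map₁; map₂; uncurry)
open import Data.Product.Properties using (≡-dec)
open import Data.Sum using (_⊎_; inj₁; inj₂)
import Data.Sum as Sum
open import Data.Vec using (Vec; []; _∷_; lookup)
open import Function using (id)
open import Relation.Binary.Definitions using (Decidable; DecidableEquality)
open import Relation.Binary.PropositionalEquality using (_≡_; _≢_; refl; sym; trans)
open import Relation.Nullary using (Dec; does; yes; no; contradiction)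
open import Relation.Nullary.Decidable using (_×-dec_; _⊎-dec_; _→-dec_; map′; True; toWitness)

source∈vertices : ∀ {G : Graph} {u v : V G} (p : Walk G u v) → u ∈ vertices p
source∈vertices (here _)       = here refl
source∈vertices (step _ _ _ _) = here refl

module _ {G : Graph} (f : V G → ℕ) where

  record SeparatingComponents (c : ℕ) (κ : V G → ℕ) : Set where
    constructor separating
    field
      constant-on-edges : ∀ u w → Adj G u w → f u ≤ c → f w ≤ c → κ u ≡ κ w
      separates-level   : ∀ u v → f u ≡ c → f v ≡ c → κ u ≡ κ v → u ≡ v

  exceeds-level-or-same-component :
    ∀ {c} {κ : V G → ℕ} → (∀ u w → Adj G u w → f u ≤ c → f w ≤ c → κ u ≡ κ w) →
    ∀ {u v} (p : Walk G u v) → f u ≤ c → (∃[ w ] (w ∈ vertices p × c < f w)) ⊎ κ u ≡ κ v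
  exceeds-level-or-same-component const (here u) _ = inj₂ refl
  exceeds-level-or-same-component {c} const (step u w adj p) fu≤c with f w ≤? c
  ... | no fw≰c  = inj₁ (w , there (source∈vertices p) , ≰⇒> fw≰c)
  ... | yes fw≤c = Sum.map (map₂ (map₁ there)) (trans (const u w adj fu≤c fw≤c))
                           (exceeds-level-or-same-component const p fw≤c)

  -- The argument works for arbitrary walks.
  ranking-from-components :
    ∀ {k} → (∀ v → 1 ≤ f v × f v ≤ k) → (κ : ℕ → V G → ℕ) →
    (∀ {c} → c < 1 + k → SeparatingComponents c (κ c)) → IsRanking G k f
  ranking-from-components range κ levels = range , separated
    where
    separated : ∀ u v → u ≢ v → f u ≡ f v → (p : Walk G u v) → IsPath p →
                ∃[ w ] (w ∈ vertices p × f u < f w)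
    separated u v u≢v fu≡fv p _ =
      Sum.[ id , (λ same → contradiction (separates-level u v refl (sym fu≡fv) same) u≢v) ]
        (exceeds-level-or-same-component constant-on-edges p ≤-refl)
      where open SeparatingComponents (levels (s≤s (proj₂ (range u))))

diff1? : Decidable Diff1
diff1? a b = (1 + a ≟ b) ⊎-dec (1 + b ≟ a)

module _ {n : ℕ} where

  qAdj? : Decidable (QAdj n)
  qAdj? (i , j) (i′ , j′) = (toℕ i ≟ toℕ i′ ×-dec diff1? (toℕ j) (toℕ j′))
                        ⊎-dec (toℕ j ≟ toℕ j′ ×-dec diff1? (toℕ i) (toℕ i′))

  _≟ᵛ_ : DecidableEquality (QVertex n)
  _≟ᵛ_ = ≡-dec _≟ᶠ_ _≟ᶠ_

  ∀-vertex? : {P : QVertex n → Set} → (∀ v → Dec (P v)) → Dec (∀ v → P v)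
  ∀-vertex? P? = map′ (λ h (i , j) → h i j) (λ h i j → h (i , j)) (all? λ i → all? λ j → P? (i , j))

  qVertices : List (QVertex n)
  qVertices = concatMap (λ i → map (i ,_) (allFin (n + toℕ i))) (allFin 4)

  ComponentTable : Set
  ComponentTable = List (QVertex n × ℕ)

  componentOf : ComponentTable → QVertex n → ℕ
  componentOf []            v = 0
  componentOf ((w , x) ∷ t) v = if does (v ≟ᵛ w) then x else componentOf t v

  module _ (f : QVertex n → ℕ) (c : ℕ) where

    sublevelAdjacent : QVertex n → QVertex n → Bool
    sublevelAdjacent v w = does (qAdj? v w) ∧ (f v ≤ᵇ c) ∧ (f w ≤ᵇ c)

    propagateMinimum : ComponentTable → ComponentTable
    propagateMinimum t = map (λ (v , x) → v , foldr (minimumOver v) x t) t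
      where
      minimumOver : QVertex n → QVertex n × ℕ → ℕ → ℕ
      minimumOver v (w , y) m = if sublevelAdjacent v w then y ⊓ m else m

    -- Starting from distinct labels, |V| rounds of propagation reach the component minima;
    -- nothing depends on this, since the result is checked by separatingComponents?.
    sublevelComponents : ComponentTable
    sublevelComponents =
      fold (zip qVertices (upTo (length qVertices))) propagateMinimum (length qVertices)

    module _ (t : ComponentTable) where

      constantOnSublevelEdges? :
        Dec (∀ u w → QAdj n u w → f u ≤ c → f w ≤ c → componentOf t u ≡ componentOf t w)
      constantOnSublevelEdges? = ∀-vertex? λ u → ∀-vertex? λ w →
        qAdj? u w →-dec f u ≤? c →-dec f w ≤? c →-dec componentOf t u ≟ componentOf t w

      separatesLevel? :
        Dec (∀ u v → f u ≡ c → f v ≡ c → componentOf t u ≡ componentOf t v → u ≡ v)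
      separatesLevel? = ∀-vertex? λ u → ∀-vertex? λ v →
        f u ≟ c →-dec f v ≟ c →-dec componentOf t u ≟ componentOf t v →-dec u ≟ᵛ v

      separatingComponents? : Dec (SeparatingComponents f c (componentOf t))
      separatingComponents? = map′ (uncurry separating) (λ s → constant-on-edges s , separates-level s)
                                   (constantOnSublevelEdges? ×-dec separatesLevel?)
        where open SeparatingComponents

  labelsWithin? : (f : QVertex n → ℕ) (k : ℕ) → Dec (∀ v → 1 ≤ f v × f v ≤ k)
  labelsWithin? f k = ∀-vertex? λ v → 1 ≤? f v ×-dec f v ≤? k

  -- The component table of each level is passed as an argument so that evaluation shares it.
  ranking-by-computation :
    (f : QVertex n → ℕ) (k : ℕ) → {True (labelsWithin? f k)} →
    {True (allUpTo? (λ c → separatingComponents? f c (sublevelComponents f c)) (1 + k))} →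
    HasRanking (Q n) k
  ranking-by-computation f k {range} {levels} =
    f , ranking-from-components f (toWitness range) (λ c → componentOf (sublevelComponents f c))
                                  (toWitness levels)

byRows : ∀ {n} → Vec ℕ (n + 0) → Vec ℕ (n + 1) → Vec ℕ (n + 2) → Vec ℕ (n + 3) → QVertex n → ℕ
byRows r₀ r₁ r₂ r₃ (zero , j)                 = lookup r₀ j
byRows r₀ r₁ r₂ r₃ (suc zero , j)             = lookup r₁ j
byRows r₀ r₁ r₂ r₃ (suc (suc zero) , j)       = lookup r₂ j
byRows r₀ r₁ r₂ r₃ (suc (suc (suc zero)) , j) = lookup r₃ j

labelling₃ : QVertex 3 → ℕ
labelling₃ = byRows (1 ∷ 2 ∷ 1 ∷ [])
                    (3 ∷ 1 ∷ 6 ∷ 2 ∷ [])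
                    (1 ∷ 5 ∷ 2 ∷ 3 ∷ 1 ∷ [])
                    (2 ∷ 1 ∷ 4 ∷ 1 ∷ 2 ∷ 1 ∷ [])

labelling₄ : QVertex 4 → ℕ
labelling₄ = byRows (2 ∷ 1 ∷ 7 ∷ 1 ∷ [])
                    (1 ∷ 6 ∷ 1 ∷ 2 ∷ 1 ∷ [])
                    (3 ∷ 1 ∷ 5 ∷ 1 ∷ 3 ∷ 1 ∷ [])
                    (1 ∷ 2 ∷ 1 ∷ 4 ∷ 1 ∷ 2 ∷ 1 ∷ [])

labelling₅ : QVertex 5 → ℕ
labelling₅ = byRows (1 ∷ 8 ∷ 3 ∷ 4 ∷ 1 ∷ [])
                    (2 ∷ 1 ∷ 7 ∷ 1 ∷ 2 ∷ 1 ∷ [])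
                    (1 ∷ 4 ∷ 1 ∷ 6 ∷ 1 ∷ 3 ∷ 1 ∷ [])
                    (3 ∷ 1 ∷ 2 ∷ 1 ∷ 5 ∷ 1 ∷ 2 ∷ 1 ∷ [])

mainTheorem8 : HasRanking (Q 3) 6 × HasRanking (Q 4) 7 × HasRanking (Q 5) 8
mainTheorem8 = ranking-by-computation labelling₃ 6
             , ranking-by-computation labelling₄ 7
             , ranking-by-computation labelling₅ 8
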